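{- For all positive integers $b$ and $r$ there is an integer $K_4$ such that the following holds. Let $\mathcal{H}$ be a hypergraph with $\chi(\mathcal{H}, b-1) \geq K_4$, and let $\mathcal{B} = (e_1, \dots, e_b)$ be a $b$-bromeliad in $\mathcal{H}$ with petals $P_1,\dots,P_b$. Then there is a sub-hypergraph $\mathcal{H}'$ of $\mathcal{H}$ and an index $j \geq 2$ such that $\chi(\mathcal{H}', b-1) \geq r$ and every edge of $\mathcal{H}'$ is disjoint from the petal $P_j$ of $e_j$.
   Context: A hypergraph $\mathcal{H}$ consists of a finite vertex set $V(\mathcal{H})$ and a set of edges, each a subset of $V(\mathcal{H})$; a sub-hypergraph is obtained by taking a subset of the edges. A colouring is a function $V(\mathcal{H}) \to \mathbb{N}$; it uses $m$ colours if its image has size $m$. A colouring is $c$-strong if every edge $e$ contains vertices of at least $\min\{c, |e|\}$ distinct colours; $\chi(\mathcal{H}, c)$ is the smallest number of colours in a $c$-strong colouring. A sequence of edges $(e_1,\dots,e_b)$ is a $b$-bromeliad if there are sets $C_i$ (cores) and $P_i$ (petals) such that for each $i$, $C_i$ and $P_i$ partition $e_i$; $e_1 = C_1 \supsetneq C_2 \supsetneq \dots \supsetneq C_b \neq \emptyset$; and $P_1,\dots,P_b,C_1$ are pairwise disjoint. (These sets are uniquely determined: $C_j = e_1 \cap e_j$ and $P_j = e_j \setminus e_1$.) -}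

module Defs where

open import Data.Nat using (ℕ; zero; suc; _≤_; _<_; _⊓_; _≟_)
open import Data.Fin using (Fin; toℕ)
open import Data.Fin.Subset using (Subset; _∈_; _∉_; _⊆_; _⊂_; _∩_; _∪_; ∣_∣; Nonempty; ⊥)
open import Data.Fin.Subset.Properties using (_∈?_)
open import Data.List using (List; length; map; filter; deduplicate; allFin)
open import Data.List.Membership.Propositional using () renaming (_∈_ to _∈ₗ_)
open import Data.Product using (Σ; _×_; _,_)
open import Relation.Binary.PropositionalEquality using (_≡_)
open import Relation.Nullary using (¬_)

-- A hypergraph on the vertex set Fin n: a (finite) list of edges, each a subset
-- of the vertices.  (Repetitions in the list are harmless: edges form a set.)
record Hypergraph (n : ℕ) : Set where
  constructor hypergraph
  field
    edges : List (Subset n)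
open Hypergraph public

SubHypergraph : ∀ {n} → Hypergraph n → Hypergraph n → Set
SubHypergraph {n} H' H = ∀ (e : Subset n) → e ∈ₗ edges H' → e ∈ₗ edges H

Colouring : ℕ → Set
Colouring n = Fin n → ℕ

verticesOf : ∀ {n} → Subset n → List (Fin n)
verticesOf e = filter (λ v → v ∈? e) (allFin _)

distinctColours : ∀ {n} → Colouring n → List (Fin n) → ℕ
distinctColours f vs = length (deduplicate _≟_ (map f vs))

coloursUsed : ∀ {n} → Colouring n → ℕ
coloursUsed f = distinctColours f (allFin _)

Strong : ∀ {n} → Hypergraph n → ℕ → Colouring n → Set
Strong {n} H c f = ∀ (e : Subset n) → e ∈ₗ edges H →
  (c ⊓ ∣ e ∣) ≤ distinctColours f (verticesOf e)

-- χ(H, c) ≥ K : the minimum number of colours of a c-strong colouring is at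
-- least K, i.e. every c-strong colouring uses at least K colours.
χ≥ : ∀ {n} → Hypergraph n → ℕ → ℕ → Set
χ≥ {n} H c K = ∀ (f : Colouring n) → Strong H c f → K ≤ coloursUsed f

Disjoint : ∀ {n} → Subset n → Subset n → Set
Disjoint {n} A B = ∀ (v : Fin n) → v ∈ A → v ∉ B

-- (e₀,…,e_{b-1}) (0-indexed; index i corresponds to e_{i+1} of the paper)
-- with cores C and petals P forms a b-bromeliad.
IsBromeliadWith : ∀ {n b} → (Fin b → Subset n) → (Fin b → Subset n) → (Fin b → Subset n) → Set
IsBromeliadWith {n} {b} e C P =
  (∀ i → (C i ∪ P i ≡ e i) × (C i ∩ P i ≡ ⊥)) ×
  (∀ i → toℕ i ≡ 0 → C i ≡ e i) ×
  (∀ i j → toℕ j ≡ suc (toℕ i) → C j ⊂ C i) ×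
  (∀ i → suc (toℕ i) ≡ b → Nonempty (C i)) ×
  (∀ i j → ¬ (i ≡ j) → Disjoint (P i) (P j)) ×
  (∀ i k → toℕ k ≡ 0 → Disjoint (P i) (C k))

IsBromeliad : ∀ {n b} → Hypergraph n → (Fin b → Subset n) → (Fin b → Subset n) → Set
IsBromeliad {n} {b} H e P =
  (∀ i → e i ∈ₗ edges H) × Σ (Fin b → Subset n) (λ C → IsBromeliadWith e C P)

{-# OPTIONS --safe #-}
-- Suppose no
-- H_j (the edges of H missing P_j, j ≥ 2) has χ(H_j, b-1) ≥ r, and pick
-- (b-1)-strong colourings g_j of H_j with r colours.  Colour each vertex by the
-- tuple of its g_j-colours together with the index of the petal containing it.
-- An edge missing some P_j is already coloured strongly by g_j; an edge meeting
-- all of P₂, …, P_b sees b-1 different petal indices.  This is a (b-1)-strong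
-- colouring of H with b·r^(b-1) colours, so K₄ = b·r^(b-1) + 1 works.
module Submission where

open import Defs
open import Data.Nat using (ℕ; suc; _≤_)
open import Data.Fin using (Fin; toℕ)
open import Data.Fin.Subset using (Subset)
open import Data.List.Membership.Propositional using (_∈_)
open import Data.Product using (Σ; _×_)

open import Data.Nat using (zero; z≤n; s≤s; _*_; _^_; _⊓_; _≤?_)
open import Data.Nat.Properties
  using (≤-trans; ≤-<-trans; <⇒≤; ≮⇒≥; 1+n≰n; m⊓n≤m; module ≤-Reasoning)
  renaming (_≟_ to _≟ℕ_)
open import Data.Fin using (zero; suc; inject≤; combine; funToFin; finToFun)
open import Data.Fin.Properties
  using (any?; suc-injective; toℕ-injective; toℕ<n; inject≤-injective;
         combine-injective; finToFun-funToFin)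
  renaming (_≟_ to _≟Fin_)
open import Data.Fin.Subset using (_∩_; ∣_∣; Nonempty) renaming (_∈_ to _∈ₛ_)
open import Data.Fin.Subset.Properties using (_∈?_; nonempty?; x∈p∩q⁺; x∈p∩q⁻)
open import Data.List using (List; []; _∷_; length; map; filter; deduplicate; allFin; upTo; tabulate; lookup)
open import Data.List.Properties using (filter-notAll; length-map; length-upTo; length-tabulate)
open import Data.List.Membership.Propositional.Properties
  using (∈-map⁺; ∈-map⁻; ∈-filter⁺; ∈-filter⁻; ∈-deduplicate⁺; ∈-deduplicate⁻;
         ∈-allFin; ∈-upTo⁺; ∈-tabulate⁻)
open import Data.List.Relation.Binary.Subset.Propositional using (_⊆_)
open import Data.List.Relation.Unary.Any using (here; there; index)
import Data.List.Relation.Unary.Any as Any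
open import Data.List.Relation.Unary.Any.Properties using (lookup-index)
import Data.List.Relation.Unary.All as All
open import Data.List.Relation.Unary.AllPairs using (_∷_)
import Data.List.Relation.Unary.AllPairs as AllPairs
import Data.List.Relation.Unary.AllPairs.Properties as AllPairs
open import Data.List.Relation.Unary.Unique.Propositional using (Unique)
open import Data.List.Relation.Unary.Unique.Propositional.Properties using (tabulate⁺)
open import Data.List.Relation.Unary.Unique.DecPropositional.Properties using (deduplicate-!)
open import Data.Product using (_,_; proj₁; proj₂; ∃)
open import Data.Sum using (_⊎_; inj₁; inj₂)
open import Data.Empty using (⊥-elim)
open import Function using (_∘_; case_of_)
open import Relation.Binary.Definitions using (DecidableEquality)
open import Relation.Binary.PropositionalEquality
  using (_≡_; _≢_; _≗_; refl; sym; trans; cong; subst; module ≡-Reasoning)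
open import Relation.Nullary using (¬_; Dec; yes; no; ¬?)
open import Relation.Nullary.Decidable using (map′; decidable-stable)

∃⊎∀ : ∀ {k} {A B : Fin k → Set} → (∀ i → A i ⊎ B i) → ∃ A ⊎ (∀ i → B i)
∃⊎∀ {zero} _ = inj₂ λ ()
∃⊎∀ {suc k} a⊎b with a⊎b zero | ∃⊎∀ (a⊎b ∘ suc)
... | inj₁ a | _ = inj₁ (zero , a)
... | inj₂ _ | inj₁ (i , a) = inj₁ (suc i , a)
... | inj₂ b | inj₂ bs = inj₂ λ { zero → b ; (suc i) → bs i }

∃-function? : ∀ {m n} {P : (Fin n → Fin m) → Set} →
              (∀ {f g} → f ≗ g → P f → P g) → (∀ f → Dec (P f)) → Dec (∃ P)
∃-function? resp P? = map′ (λ (i , p) → finToFun i , p)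
  (λ (f , p) → funToFin f , resp (sym ∘ finToFun-funToFin f) p)
  (any? (P? ∘ finToFun))

funToFin-injective : ∀ {m n} {f g : Fin m → Fin n} → funToFin f ≡ funToFin g → f ≗ g
funToFin-injective {f = f} {g} eq i = begin
  f i                     ≡⟨ finToFun-funToFin f i ⟨
  finToFun (funToFin f) i ≡⟨ cong (λ c → finToFun c i) eq ⟩
  finToFun (funToFin g) i ≡⟨ finToFun-funToFin g i ⟩
  g i                     ∎
  where open ≡-Reasoning

module _ {A : Set} (_≟_ : DecidableEquality A) where

  Unique⇒length≤ : ∀ {xs ys : List A} → Unique xs → xs ⊆ ys → length xs ≤ length ys
  Unique⇒length≤ {[]} _ _ = z≤n
  Unique⇒length≤ {x ∷ xs} {ys} (x∉xs ∷ xs-unique) x∷xs⊆ys =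
    ≤-<-trans (Unique⇒length≤ xs-unique xs⊆ys-x)
              (filter-notAll ≢x? ys (Any.map (λ x≡y x≢y → x≢y x≡y) (x∷xs⊆ys (here refl))))
    where
    ≢x? = λ y → ¬? (x ≟ y)
    xs⊆ys-x : xs ⊆ filter ≢x? ys
    xs⊆ys-x z∈xs = ∈-filter⁺ ≢x? (x∷xs⊆ys (there z∈xs)) (All.lookup x∉xs z∈xs)

representatives : ∀ {A B : Set} (f : A → B) (xs : List A) (ys : List B) →
                  ys ⊆ map f xs → Σ (List A) λ ws → map f ws ≡ ys × ws ⊆ xs
representatives f xs [] _ = [] , refl , λ ()
representatives f xs (y ∷ ys) y∷ys⊆fxs
  with ∈-map⁻ f (y∷ys⊆fxs (here refl)) | representatives f xs ys (y∷ys⊆fxs ∘ there)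
... | w , w∈xs , refl | ws , fws≡ys , ws⊆xs =
  w ∷ ws , cong (f w ∷_) fws≡ys , λ { (here refl) → w∈xs ; (there w′∈ws) → ws⊆xs w′∈ws }

Refines : ∀ {A B C : Set} → (A → B) → (A → C) → Set
Refines g f = ∀ {u v} → g u ≡ g v → f u ≡ f v

Refines-toℕ : ∀ {A : Set} {a b} {g : A → Fin a} {f : A → Fin b} →
              Refines g f → Refines (toℕ ∘ g) (toℕ ∘ f)
Refines-toℕ g⇒f eq = cong toℕ (g⇒f (toℕ-injective eq))

module _ {A B C : Set} (_≟B_ : DecidableEquality B) (_≟C_ : DecidableEquality C) where

  length-deduplicate-map-refine : (f : A → B) (g : A → C) → Refines g f → ∀ xs →
    length (deduplicate _≟B_ (map f xs)) ≤ length (deduplicate _≟C_ (map g xs))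
  length-deduplicate-map-refine f g g⇒f xs
    with ws , fws≡Df , ws⊆xs ← representatives f xs _ (∈-deduplicate⁻ _≟B_ (map f xs)) = begin
      length (deduplicate _≟B_ (map f xs)) ≡⟨ cong length fws≡Df ⟨
      length (map f ws)                    ≡⟨ length-map f ws ⟩
      length ws                            ≡⟨ length-map g ws ⟨
      length (map g ws)                    ≤⟨ Unique⇒length≤ _≟C_ gws-unique gws⊆Dg ⟩
      length (deduplicate _≟C_ (map g xs)) ∎
    where
    open ≤-Reasoning
    gws-unique : Unique (map g ws)
    gws-unique = AllPairs.map⁺ (AllPairs.map (λ fu≢fv → fu≢fv ∘ g⇒f) (AllPairs.map⁻
      (subst Unique (sym fws≡Df) (deduplicate-! _≟B_ (map f xs)))))
    gws⊆Dg : map g ws ⊆ deduplicate _≟C_ (map g xs)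
    gws⊆Dg z∈gws with w , w∈ws , refl ← ∈-map⁻ g z∈gws =
      ∈-deduplicate⁺ _≟C_ (∈-map⁺ g (ws⊆xs w∈ws))

distinctColours-refine : ∀ {n} {f g : Colouring n} → Refines g f → ∀ vs →
                         distinctColours f vs ≤ distinctColours g vs
distinctColours-refine {f = f} {g} = length-deduplicate-map-refine _≟ℕ_ _≟ℕ_ f g

≤-distinctColours : ∀ {m n} (f : Colouring n) (vs : List (Fin n)) (w : Fin m → Fin n) →
                    (∀ i → w i ∈ vs) → (∀ {i j} → f (w i) ≡ f (w j) → i ≡ j) →
                    m ≤ distinctColours f vs
≤-distinctColours f vs w w∈vs f∘w-injective =
  subst (_≤ distinctColours f vs) (length-tabulate (f ∘ w))
    (Unique⇒length≤ _≟ℕ_ (tabulate⁺ f∘w-injective) f∘w⊆colours)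
  where
  f∘w⊆colours : tabulate (f ∘ w) ⊆ deduplicate _≟ℕ_ (map f vs)
  f∘w⊆colours z∈ with i , refl ← ∈-tabulate⁻ z∈ = ∈-deduplicate⁺ _≟ℕ_ (∈-map⁺ f (w∈vs i))

coloursUsed-≤ : ∀ {n N} (F : Fin n → Fin N) → coloursUsed (toℕ ∘ F) ≤ N
coloursUsed-≤ {n} {N} F = subst (coloursUsed (toℕ ∘ F) ≤_) (length-upTo N)
  (Unique⇒length≤ _≟ℕ_ (deduplicate-! _≟ℕ_ _) colours⊆upTo)
  where
  colours⊆upTo : deduplicate _≟ℕ_ (map (toℕ ∘ F) (allFin n)) ⊆ upTo N
  colours⊆upTo z∈ with v , _ , refl ← ∈-map⁻ (toℕ ∘ F) (∈-deduplicate⁻ _≟ℕ_ _ z∈) =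
    ∈-upTo⁺ (toℕ<n (F v))

∈-verticesOf : ∀ {n} {v : Fin n} {e : Subset n} → v ∈ₛ e → v ∈ verticesOf e
∈-verticesOf {v = v} {e} v∈e = ∈-filter⁺ (_∈? e) (∈-allFin v) v∈e

compress : ∀ {n r} (f : Colouring n) → coloursUsed f ≤ r →
           Σ (Fin n → Fin r) λ g → Refines (toℕ ∘ g) f
compress {n} {r} f f≤r = g , g⇒f
  where
  colours = deduplicate _≟ℕ_ (map f (allFin n))
  colour∈ : ∀ v → f v ∈ colours
  colour∈ v = ∈-deduplicate⁺ _≟ℕ_ (∈-map⁺ f (∈-allFin v))
  g : Fin n → Fin r
  g v = inject≤ (index (colour∈ v)) f≤r
  g⇒f : Refines (toℕ ∘ g) f
  g⇒f {u} {v} eq = begin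
    f u                                ≡⟨ lookup-index (colour∈ u) ⟩
    lookup colours (index (colour∈ u)) ≡⟨ cong (lookup colours) same-index ⟩
    lookup colours (index (colour∈ v)) ≡⟨ lookup-index (colour∈ v) ⟨
    f v                                ∎
    where
    open ≡-Reasoning
    same-index = inject≤-injective f≤r f≤r _ _ (toℕ-injective eq)

Strong-refine : ∀ {n} {H : Hypergraph n} {c} {f g : Colouring n} →
                Refines g f → Strong H c f → Strong H c g
Strong-refine g⇒f f-strong e e∈H = ≤-trans (f-strong e e∈H) (distinctColours-refine g⇒f (verticesOf e))

strong? : ∀ {n} (H : Hypergraph n) c (f : Colouring n) → Dec (Strong H c f)
strong? H c f = map′ (λ strong e → All.lookup strong) (λ strong → All.tabulate (strong _))
  (All.all? (λ e → c ⊓ ∣ e ∣ ≤? distinctColours f (verticesOf e)) (edges H))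

χ≥⊎strongColouring : ∀ {n} (H : Hypergraph n) c r →
                     χ≥ H c r ⊎ Σ (Fin n → Fin r) λ g → Strong H c (toℕ ∘ g)
χ≥⊎strongColouring H c r with ∃-function? resp (λ g → strong? H c (toℕ ∘ g))
  where
  resp : ∀ {f g} → f ≗ g → Strong H c (toℕ ∘ f) → Strong H c (toℕ ∘ g)
  resp f≗g = Strong-refine (Refines-toℕ λ {u} {v} gu≡gv → trans (f≗g u) (trans gu≡gv (sym (f≗g v))))
... | yes colouring = inj₂ colouring
... | no ∄colouring = inj₁ λ f f-strong → ≮⇒≥ λ f<r →
  let g , g⇒f = compress f (<⇒≤ f<r) in ∄colouring (g , Strong-refine g⇒f f-strong)

χ≥⇒≤ : ∀ {n N} {H : Hypergraph n} {c K} → χ≥ H c K →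
       (F : Fin n → Fin N) → Strong H c (toℕ ∘ F) → K ≤ N
χ≥⇒≤ χH F F-strong = ≤-trans (χH (toℕ ∘ F) F-strong) (coloursUsed-≤ F)

module _ {n} (H : Hypergraph n) (S : Subset n) where

  avoiding : Hypergraph n
  avoiding = hypergraph (filter (λ e → ¬? (nonempty? (e ∩ S))) (edges H))

  avoiding-sub : SubHypergraph avoiding H
  avoiding-sub e e∈ = proj₁ (∈-filter⁻ (λ e → ¬? (nonempty? (e ∩ S))) {xs = edges H} e∈)

  avoiding-disjoint : (e : Subset n) → e ∈ edges avoiding → Disjoint e S
  avoiding-disjoint e e∈ v v∈e v∈S =
    proj₂ (∈-filter⁻ (λ e → ¬? (nonempty? (e ∩ S))) {xs = edges H} e∈) (v , x∈p∩q⁺ (v∈e , v∈S))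

  avoiding⁺ : ∀ {e} → e ∈ edges H → ¬ Nonempty (e ∩ S) → e ∈ edges avoiding
  avoiding⁺ = ∈-filter⁺ (λ e → ¬? (nonempty? (e ∩ S)))

module _ {m n} (Q : Fin m → Subset n) where

  petalIndex : Fin n → Fin (suc m)
  petalIndex v with any? (λ i → v ∈? Q i)
  ... | yes (i , _) = suc i
  ... | no _ = zero

  petalIndex-∈ : (∀ i j → i ≢ j → Disjoint (Q i) (Q j)) →
                 ∀ {v i} → v ∈ₛ Q i → petalIndex v ≡ suc i
  petalIndex-∈ Q-disjoint {v} {i} v∈Qi with any? (λ j → v ∈? Q j)
  ... | yes (j , v∈Qj) = cong suc (decidable-stable (j ≟Fin i) λ j≢i → Q-disjoint j i j≢i v v∈Qj v∈Qi)
  ... | no v∉⋃Q = ⊥-elim (v∉⋃Q (i , v∈Qi))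

  petalIndex-distinctColours : (∀ i j → i ≢ j → Disjoint (Q i) (Q j)) →
    ∀ {e} → (∀ i → Nonempty (e ∩ Q i)) → m ≤ distinctColours (toℕ ∘ petalIndex) (verticesOf e)
  petalIndex-distinctColours Q-disjoint {e} meets =
    ≤-distinctColours _ _ w (λ i → ∈-verticesOf (proj₁ (w∈e∩Q i))) w-separated
    where
    w : Fin m → Fin n
    w i = proj₁ (meets i)
    w∈e∩Q : ∀ i → w i ∈ₛ e × w i ∈ₛ Q i
    w∈e∩Q i = x∈p∩q⁻ e (Q i) (proj₂ (meets i))
    index-w : ∀ i → petalIndex (w i) ≡ suc i
    index-w i = petalIndex-∈ Q-disjoint (proj₂ (w∈e∩Q i))
    w-separated : ∀ {i j} → toℕ (petalIndex (w i)) ≡ toℕ (petalIndex (w j)) → i ≡ j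
    w-separated {i} {j} eq = suc-injective (trans (sym (index-w i)) (trans (toℕ-injective eq) (index-w j)))

module _ {A : Set} {a m r} (p : A → Fin a) (g : Fin m → A → Fin r) where

  tupleColouring : A → Fin (r ^ m)
  tupleColouring x = funToFin (λ i → g i x)

  productColouring : A → Fin (a * r ^ m)
  productColouring x = combine (p x) (tupleColouring x)

  productColouring-refinesˡ : Refines productColouring p
  productColouring-refinesˡ {u} {v} eq =
    proj₁ (combine-injective (p u) (tupleColouring u) (p v) (tupleColouring v) eq)

  productColouring-refinesʳ : ∀ i → Refines productColouring (g i)
  productColouring-refinesʳ i {u} {v} eq = funToFin-injective
    (proj₂ (combine-injective (p u) (tupleColouring u) (p v) (tupleColouring v) eq)) i

strongColouring-from-avoiding : ∀ {m n r} (H : Hypergraph n) (Q : Fin m → Subset n) →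
  (∀ i j → i ≢ j → Disjoint (Q i) (Q j)) →
  (∀ i → Σ (Fin n → Fin r) λ g → Strong (avoiding H (Q i)) m (toℕ ∘ g)) →
  Σ (Fin n → Fin (suc m * r ^ m)) λ F → Strong H m (toℕ ∘ F)
strongColouring-from-avoiding {m} H Q Q-disjoint colourings = F , F-strong
  where
  g = λ i → proj₁ (colourings i)
  F = productColouring (petalIndex Q) g
  F-refines-g : ∀ i → Refines (toℕ ∘ F) (toℕ ∘ g i)
  F-refines-g i = Refines-toℕ {g = F} (productColouring-refinesʳ (petalIndex Q) g i)
  F-refines-petalIndex : Refines (toℕ ∘ F) (toℕ ∘ petalIndex Q)
  F-refines-petalIndex = Refines-toℕ {g = F} (productColouring-refinesˡ (petalIndex Q) g)
  F-strong : Strong H m (toℕ ∘ F)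
  F-strong e e∈H with any? (λ i → ¬? (nonempty? (e ∩ Q i)))
  ... | yes (i , e-avoids-Qi) =
    ≤-trans (proj₂ (colourings i) e (avoiding⁺ H (Q i) e∈H e-avoids-Qi))
            (distinctColours-refine (F-refines-g i) (verticesOf e))
  ... | no ¬avoids = ≤-trans (m⊓n≤m m _) (≤-trans
    (petalIndex-distinctColours Q Q-disjoint λ i →
       decidable-stable (nonempty? (e ∩ Q i)) λ e-avoids-Qi → ¬avoids (i , e-avoids-Qi))
    (distinctColours-refine F-refines-petalIndex (verticesOf e)))

lemma3p4 : (k r : ℕ) → 1 ≤ r →
    Σ ℕ λ K₄ →
      (n : ℕ) (H : Hypergraph n) → χ≥ H k K₄ →
      (e : Fin (suc k) → Subset n) (P : Fin (suc k) → Subset n) →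
      IsBromeliad H e P →
      Σ (Hypergraph n) λ H' → Σ (Fin (suc k)) λ j →
        SubHypergraph H' H × 1 ≤ toℕ j × χ≥ H' k r ×
        ((f : Subset n) → f ∈ edges H' → Disjoint f (P j))
lemma3p4 k r _ = suc (suc k * r ^ k) , λ n H χH e P (_ , _ , _ , _ , _ , _ , P-disjoint , _) →
  let Q = P ∘ suc
      Q-disjoint = λ i j i≢j → P-disjoint (suc i) (suc j) (i≢j ∘ suc-injective)
  in case ∃⊎∀ (λ i → χ≥⊎strongColouring (avoiding H (Q i)) k r) of λ where
    (inj₁ (i , χ≥r)) →
      avoiding H (Q i) , suc i , avoiding-sub H (Q i) , s≤s z≤n , χ≥r , avoiding-disjoint H (Q i)
    (inj₂ colourings) →
      let F , F-strong = strongColouring-from-avoiding H Q Q-disjoint colourings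
      in ⊥-elim (1+n≰n (χ≥⇒≤ χH F F-strong))
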